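{- Consider a sequence of operations on an array of size $n$ (updates and queries, types fixed in advance), each touching an index chosen uniformly and independently at random from $\{1,\dots,n\}$. Consider two adjacent intervals of operations such that the left interval contains $L$ updates, the right interval contains $L$ queries, and together they contain $O(n^{1/3})$ operations. Let $a_1\le a_2\le\dots\le a_L$ be the indices touched by the updates of the left interval and $b_1\le b_2\le\dots\le b_L$ the indices touched by the queries of the right interval, and let the interleaving number $l$ be the number of indices $i\in\{1,\dots,L-1\}$ for which there exists $j$ with $a_i<b_j\le a_{i+1}$. Then $E[l]=\Theta(L)$, and with probability $1-o(1)$ no index is touched by more than one operation of the two intervals.
   Context: Two intervals of operations are adjacent if they are consecutive time intervals $[i,j-1]$ and $[j,k]$ of the sequence. The $o(1)$ is as $n\to\infty$. -}

module Defs where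

open import Data.Bool using (Bool; true; false; if_then_else_; _∧_; _∨_; not)
open import Data.Nat using (ℕ; zero; suc; _+_; _*_; _^_; _<ᵇ_; _≡ᵇ_)
open import Data.Nat.Properties using (≤-decTotalOrder)
open import Data.Fin using (Fin; toℕ)
open import Data.List using (List; []; _∷_; map; concatMap; allFin; length; filter)
open import Data.Bool.ListAction using (any)
open import Data.Nat.ListAction using (sum)
open import Data.Vec using (Vec; take; drop; toList) renaming ([] to []ᵥ; _∷_ to _∷ᵥ_)
open import Data.List.Sort.InsertionSort.Base ≤-decTotalOrder using (sort)
open import Relation.Nullary.Decidable using (T?)

_≤ᵇ'_ : ℕ → ℕ → Bool
x ≤ᵇ' y = (x <ᵇ y) ∨ (x ≡ᵇ y)

data Op : Set where
  upd qry : Op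

isOp : Op → Op → Bool
isOp upd upd = true
isOp qry qry = true
isOp _   _   = false

-- All outcomes of m independent uniform index choices in {0,…,n-1}
-- (0-based; order comparisons are unaffected).  Each outcome appears
-- exactly once, so the uniform measure gives each weight 1/n^m.
allVecs : (n m : ℕ) → List (Vec (Fin n) m)
allVecs n zero    = []ᵥ ∷ []
allVecs n (suc m) = concatMap (λ i → map (i ∷ᵥ_) (allVecs n m)) (allFin n)

touched : ∀ {n} → Op → (ops : List Op) → Vec (Fin n) (length ops) → List ℕ
touched o []         []ᵥ        = []
touched o (p ∷ ops) (i ∷ᵥ is) =
  if isOp o p then toℕ i ∷ touched o ops is else touched o ops is

countOp : Op → List Op → ℕ
countOp o ops = length (filter (λ p → T? (isOp o p)) ops)

interleaveCount : List ℕ → List ℕ → ℕ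
interleaveCount (x ∷ y ∷ as) bs =
  (if any (λ b → (x <ᵇ b) ∧ (b ≤ᵇ' y)) bs then 1 else 0) + interleaveCount (y ∷ as) bs
interleaveCount _ _ = 0

interleaving : ∀ {n} (left right : List Op) →
               Vec (Fin n) (length left + length right) → ℕ
interleaving {n} left right ω =
  interleaveCount (sort (touched upd left (take (length left) ω)))
                  (sort (touched qry right (drop (length left) ω)))

hasDup : List ℕ → Bool
hasDup []       = false
hasDup (x ∷ xs) = any (λ y → x ≡ᵇ y) xs ∨ hasDup xs

-- Σ_ω l(ω) over all n^m equally likely outcomes (so E[l] = this / n^m).
sumInterleaving : (n : ℕ) (left right : List Op) → ℕ
sumInterleaving n left right =
  sum (map (interleaving left right) (allVecs n (length left + length right)))

-- Number of outcomes in which some index is touched by more than one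
-- operation of the two intervals (so P(collision) = this / n^m).
collisionCount : (n : ℕ) (left right : List Op) → ℕ
collisionCount n left right =
  length (filter (λ ω → T? (hasDup (map toℕ (toList ω))))
                 (allVecs n (length left + length right)))

{-# OPTIONS --safe #-}
-- Integrating out the operations of the other type reduces E[l] to the case of L uniform update
-- indices followed by L uniform query indices, and there l ≤ L trivially. For the lower bound split
-- the updates into halves of sizes h = ⌊L/2⌋ ≤ r, and cut [0, n) into h blocks of three consecutive
-- windows of width w ≈ n / 3h. A group of at least h uniform indices hits a fixed window with
-- probability at least 1/7 (Bernoulli's inequality), the three groups are independent, and every
-- block whose left, middle and right windows are hit by the first half, the queries and the second
-- half respectively contributes its own interleaving; hence E[l] ≥ h/343 ≥ L/1029.
-- By the union bound m uniform indices collide with probability at most m²/n, which is o(1) when m³ = O(n).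
module Submission where

open import Defs
open import Data.Nat using (ℕ; _+_; _*_; _^_; _≤_)
open import Data.List using (List; length)
open import Data.Product using (Σ; _×_)
open import Relation.Binary.PropositionalEquality using (_≡_)

open import Data.Bool using (Bool; true; false; if_then_else_; _∧_; _∨_; not; T)
open import Data.Bool.ListAction using (any)
open import Data.Bool.Properties using (T-∧; T-∨; T-≡)
open import Data.Fin using (Fin; toℕ) renaming (zero to fzero; suc to fsuc)
open import Data.List using ([]; _∷_; _++_; map; concatMap; allFin; filter)
open import Data.List.Properties using (map-++; map-∘; map-tabulate; length-map; length-tabulate)
open import Data.List.Membership.Propositional using (_∈_; find; lose)
open import Data.List.Membership.Propositional.Properties using (∈-++⁺ˡ; ∈-++⁺ʳ)
open import Data.List.Relation.Binary.Permutation.Propositional using (↭-sym)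
open import Data.List.Relation.Binary.Permutation.Propositional.Properties using (∈-resp-↭; ↭-length)
open import Data.List.Relation.Unary.All using (All)
import Data.List.Relation.Unary.All as All
open import Data.List.Relation.Unary.AllPairs using (AllPairs; _∷_)
open import Data.List.Relation.Unary.Any using (here; there)
open import Data.List.Relation.Unary.Any.Properties using (any⁺; any⁻)
open import Data.List.Relation.Unary.Linked.Properties using (Linked⇒AllPairs)
open import Data.Nat using (zero; suc; _<_; NonZero; >-nonZero; z≤n; s≤s; _≤ᵇ_; _<ᵇ_; _≡ᵇ_; ⌊_/2⌋; ⌈_/2⌉)
open import Data.Nat.DivMod using (_/_; _%_; m≡m%n+[m/n]*n; m%n<n; m/n*n≤m; m≥n⇒m/n>0)
open import Data.Nat.ListAction using (sum)
open import Data.Nat.ListAction.Properties using (sum-++)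
open import Data.Nat.Properties
open import Data.Nat.Tactic.RingSolver using (solve-∀)
open import Algebra.Properties.CommutativeSemigroup +-commutativeSemigroup using () renaming (interchange to +-interchange)
open import Algebra.Properties.CommutativeSemigroup *-commutativeSemigroup using () renaming (x∙yz≈y∙xz to *-left-swap)
open import Data.List.Sort.InsertionSort.Base ≤-decTotalOrder using (sort)
open import Data.List.Sort.InsertionSort.Properties ≤-decTotalOrder using (sort-↭; sort-↗)
open import Data.Product using (_,_; proj₁; proj₂)
open import Data.Sum using (inj₁; inj₂)
open import Data.Unit using (tt)
open import Data.Vec using (Vec; toList; head; tail; take; drop) renaming ([] to []ᵥ; _∷_ to _∷ᵥ_; _++_ to _++ᵥ_)
open import Data.Vec.Properties using (take++drop≡id; toList-++; length-toList)
open import Function using (_∘_; Equivalence)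
open import Relation.Binary.PropositionalEquality using (refl; sym; trans; cong; cong₂; subst; module ≡-Reasoning)
open import Relation.Nullary using (¬_; contradiction; yes; no)
open import Relation.Nullary.Decidable using (T?)

private
  variable
    A B : Set

𝟙 : Bool → ℕ
𝟙 b = if b then 1 else 0

𝟙≤1 : ∀ b → 𝟙 b ≤ 1
𝟙≤1 true  = s≤s z≤n
𝟙≤1 false = z≤n

𝟙-∨ : ∀ a b → 𝟙 (a ∨ b) ≤ 𝟙 a + 𝟙 b
𝟙-∨ true  b = s≤s z≤n
𝟙-∨ false b = ≤-refl

𝟙-not-∨ : ∀ a b → 𝟙 (not (a ∨ b)) ≡ 𝟙 (not a) * 𝟙 (not b)
𝟙-not-∨ true  b = refl
𝟙-not-∨ false b = sym (+-identityʳ _)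

𝟙+𝟙-not : ∀ b → 𝟙 b + 𝟙 (not b) ≡ 1
𝟙+𝟙-not true  = refl
𝟙+𝟙-not false = refl

-- Sums over outcomes

sumOver : List A → (A → ℕ) → ℕ
sumOver xs f = sum (map f xs)

sumOver-cong : ∀ (xs : List A) {f g} → (∀ x → f x ≡ g x) → sumOver xs f ≡ sumOver xs g
sumOver-cong []       f≡g = refl
sumOver-cong (x ∷ xs) f≡g = cong₂ _+_ (f≡g x) (sumOver-cong xs f≡g)

sumOver-mono : ∀ (xs : List A) {f g} → (∀ x → f x ≤ g x) → sumOver xs f ≤ sumOver xs g
sumOver-mono []       f≤g = z≤n
sumOver-mono (x ∷ xs) f≤g = +-mono-≤ (f≤g x) (sumOver-mono xs f≤g)

sumOver-+ : ∀ (xs : List A) f g → sumOver xs (λ x → f x + g x) ≡ sumOver xs f + sumOver xs g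
sumOver-+ []       f g = refl
sumOver-+ (x ∷ xs) f g = begin
  f x + g x + sumOver xs (λ x → f x + g x)     ≡⟨ cong (f x + g x +_) (sumOver-+ xs f g) ⟩
  f x + g x + (sumOver xs f + sumOver xs g)   ≡⟨ +-interchange (f x) (g x) _ _ ⟩
  f x + sumOver xs f + (g x + sumOver xs g)   ∎
  where open ≡-Reasoning

sumOver-*ˡ : ∀ (xs : List A) c f → sumOver xs (λ x → c * f x) ≡ c * sumOver xs f
sumOver-*ˡ []       c f = sym (*-zeroʳ c)
sumOver-*ˡ (x ∷ xs) c f = trans (cong (c * f x +_) (sumOver-*ˡ xs c f)) (sym (*-distribˡ-+ c (f x) _))

sumOver-*ʳ : ∀ (xs : List A) c f → sumOver xs (λ x → f x * c) ≡ sumOver xs f * c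
sumOver-*ʳ xs c f = begin
  sumOver xs (λ x → f x * c)  ≡⟨ sumOver-cong xs (λ x → *-comm (f x) c) ⟩
  sumOver xs (λ x → c * f x)  ≡⟨ sumOver-*ˡ xs c f ⟩
  c * sumOver xs f            ≡⟨ *-comm c _ ⟩
  sumOver xs f * c            ∎
  where open ≡-Reasoning

sumOver-const : ∀ (xs : List A) c → sumOver xs (λ _ → c) ≡ length xs * c
sumOver-const []       c = refl
sumOver-const (x ∷ xs) c = cong (c +_) (sumOver-const xs c)

sumOver-++ : ∀ (xs ys : List A) f → sumOver (xs ++ ys) f ≡ sumOver xs f + sumOver ys f
sumOver-++ xs ys f = trans (cong sum (map-++ f xs ys)) (sum-++ (map f xs) (map f ys))

sumOver-product : ∀ (xs : List A) (ys : List B) f g →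
                  sumOver xs (λ x → sumOver ys (λ y → f x * g y)) ≡ sumOver xs f * sumOver ys g
sumOver-product xs ys f g = begin
  sumOver xs (λ x → sumOver ys (λ y → f x * g y))  ≡⟨ sumOver-cong xs (λ x → sumOver-*ˡ ys (f x) g) ⟩
  sumOver xs (λ x → f x * sumOver ys g)            ≡⟨ sumOver-*ʳ xs _ f ⟩
  sumOver xs f * sumOver ys g                      ∎
  where open ≡-Reasoning

sumOver-map : ∀ (xs : List A) (g : A → B) f → sumOver (map g xs) f ≡ sumOver xs (f ∘ g)
sumOver-map xs g f = cong sum (sym (map-∘ xs))

sumOver-concatMap : ∀ (xs : List A) (h : A → List B) f →
                    sumOver (concatMap h xs) f ≡ sumOver xs (λ x → sumOver (h x) f)
sumOver-concatMap []       h f = refl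
sumOver-concatMap (x ∷ xs) h f =
  trans (sumOver-++ (h x) (concatMap h xs) f) (cong (sumOver (h x) f +_) (sumOver-concatMap xs h f))

sumFin : (n : ℕ) → (Fin n → ℕ) → ℕ
sumFin n = sumOver (allFin n)

sumFin-const : ∀ n c → sumFin n (λ _ → c) ≡ n * c
sumFin-const n c = trans (sumOver-const (allFin n) c) (cong (_* c) (length-tabulate {n = n} (λ i → i)))

sumFin-suc : ∀ n (f : Fin (suc n) → ℕ) → sumFin (suc n) f ≡ f fzero + sumFin n (f ∘ fsuc)
sumFin-suc n f = cong (λ xs → f fzero + sum xs) (trans (map-tabulate fsuc f) (sym (map-tabulate (λ i → i) (f ∘ fsuc))))

sumBelow : ℕ → (ℕ → ℕ) → ℕ
sumBelow zero    g = 0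
sumBelow (suc n) g = g 0 + sumBelow n (g ∘ suc)

sumFin-toℕ : ∀ n g → sumFin n (g ∘ toℕ) ≡ sumBelow n g
sumFin-toℕ zero    g = refl
sumFin-toℕ (suc n) g = trans (sumFin-suc n (g ∘ toℕ)) (cong (g 0 +_) (sumFin-toℕ n (g ∘ suc)))

sumBelow-+ : ∀ a b g → sumBelow (a + b) g ≡ sumBelow a g + sumBelow b (λ i → g (a + i))
sumBelow-+ zero    b g = refl
sumBelow-+ (suc a) b g = trans (cong (g 0 +_) (sumBelow-+ a b (g ∘ suc))) (sym (+-assoc (g 0) _ _))

sumBelow-const : ∀ n c g → (∀ i → i < n → g i ≡ c) → sumBelow n g ≡ n * c
sumBelow-const zero    c g g≡c = refl
sumBelow-const (suc n) c g g≡c =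
  cong₂ _+_ (g≡c 0 (s≤s z≤n)) (sumBelow-const n c (g ∘ suc) (λ i i<n → g≡c (suc i) (s≤s i<n)))

sumVec : (n m : ℕ) → (Vec (Fin n) m → ℕ) → ℕ
sumVec n m = sumOver (allVecs n m)

sumVec-zero : ∀ n f → sumVec n 0 f ≡ f []ᵥ
sumVec-zero n f = +-identityʳ _

sumVec-suc : ∀ n m f → sumVec n (suc m) f ≡ sumFin n (λ i → sumVec n m (λ u → f (i ∷ᵥ u)))
sumVec-suc n m f = begin
  sumOver (concatMap (λ i → map (i ∷ᵥ_) (allVecs n m)) (allFin n)) f
    ≡⟨ sumOver-concatMap (allFin n) _ f ⟩
  sumFin n (λ i → sumOver (map (i ∷ᵥ_) (allVecs n m)) f)
    ≡⟨ sumOver-cong (allFin n) (λ i → sumOver-map (allVecs n m) (i ∷ᵥ_) f) ⟩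
  sumFin n (λ i → sumVec n m (λ u → f (i ∷ᵥ u)))  ∎
  where open ≡-Reasoning

sumVec-const : ∀ n m c → sumVec n m (λ _ → c) ≡ c * n ^ m
sumVec-const n zero    c = trans (+-identityʳ c) (sym (*-identityʳ c))
sumVec-const n (suc m) c = begin
  sumVec n (suc m) (λ _ → c)             ≡⟨ sumVec-suc n m _ ⟩
  sumFin n (λ _ → sumVec n m (λ _ → c))  ≡⟨ sumFin-const n _ ⟩
  n * sumVec n m (λ _ → c)               ≡⟨ cong (n *_) (sumVec-const n m c) ⟩
  n * (c * n ^ m)                        ≡⟨ *-left-swap n c (n ^ m) ⟩
  c * (n * n ^ m)                        ∎
  where open ≡-Reasoning

sumVec-split : ∀ n p q (g : Vec (Fin n) p → Vec (Fin n) q → ℕ) →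
               sumVec n (p + q) (λ ω → g (take p ω) (drop p ω)) ≡ sumVec n p (λ u → sumVec n q (g u))
sumVec-split n zero    q g = sym (+-identityʳ _)
sumVec-split n (suc p) q g = begin
  sumVec n (suc p + q) (λ ω → g (take (suc p) ω) (drop (suc p) ω))
    ≡⟨ sumVec-suc n (p + q) _ ⟩
  sumFin n (λ i → sumVec n (p + q) (λ ω → g (i ∷ᵥ take p ω) (drop p ω)))
    ≡⟨ sumOver-cong (allFin n) (λ i → sumVec-split n p q (g ∘ (i ∷ᵥ_))) ⟩
  sumFin n (λ i → sumVec n p (λ u → sumVec n q (g (i ∷ᵥ u))))
    ≡⟨ sumVec-suc n p _ ⟨
  sumVec n (suc p) (λ u → sumVec n q (g u))  ∎
  where open ≡-Reasoning

sumVec-++ : ∀ n p q f → sumVec n (p + q) f ≡ sumVec n p (λ u → sumVec n q (λ v → f (u ++ᵥ v)))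
sumVec-++ n p q f = trans (sumOver-cong (allVecs n (p + q)) (λ ω → cong f (sym (take++drop≡id p ω))))
                          (sumVec-split n p q (λ u v → f (u ++ᵥ v)))

sumVec-head : ∀ n m f → sumVec n (suc m) (f ∘ head) ≡ sumFin n f * n ^ m
sumVec-head n m f = begin
  sumVec n (suc m) (f ∘ head)                 ≡⟨ sumVec-suc n m _ ⟩
  sumFin n (λ i → sumVec n m (λ _ → f i))     ≡⟨ sumOver-cong (allFin n) (λ i → sumVec-const n m (f i)) ⟩
  sumFin n (λ i → f i * n ^ m)                ≡⟨ sumOver-*ʳ (allFin n) _ f ⟩
  sumFin n f * n ^ m                          ∎
  where open ≡-Reasoning

sumVec-tail : ∀ n m f → sumVec n (suc m) (f ∘ tail) ≡ n * sumVec n m f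
sumVec-tail n m f = trans (sumVec-suc n m _) (sumFin-const n _)

indices : ∀ {n m} → Vec (Fin n) m → List ℕ
indices u = map toℕ (toList u)

hitCount : (n m : ℕ) → (ℕ → Bool) → ℕ
hitCount n m p = sumVec n m (λ u → 𝟙 (any p (indices u)))

missCount : (n m : ℕ) → (ℕ → Bool) → ℕ
missCount n m p = sumVec n m (λ u → 𝟙 (not (any p (indices u))))

hitCount+missCount : ∀ n m p → hitCount n m p + missCount n m p ≡ n ^ m
hitCount+missCount n m p = begin
  hitCount n m p + missCount n m p                    ≡⟨ sumOver-+ (allVecs n m) _ _ ⟨
  sumVec n m (λ u → 𝟙 (any p (indices u)) + 𝟙 (not (any p (indices u))))
                                                      ≡⟨ sumOver-cong (allVecs n m) (λ u → 𝟙+𝟙-not (any p (indices u))) ⟩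
  sumVec n m (λ _ → 1)                                ≡⟨ sumVec-const n m 1 ⟩
  1 * n ^ m                                           ≡⟨ *-identityˡ _ ⟩
  n ^ m                                               ∎
  where open ≡-Reasoning

missCount-power : ∀ n m p → missCount n m p ≡ sumBelow n (λ x → 𝟙 (not (p x))) ^ m
missCount-power n zero    p = sumVec-zero n (λ u → 𝟙 (not (any p (indices u))))
missCount-power n (suc m) p = begin
  missCount n (suc m) p
    ≡⟨ sumVec-suc n m _ ⟩
  sumFin n (λ i → sumVec n m (λ u → 𝟙 (not (p (toℕ i) ∨ any p (indices u)))))
    ≡⟨ sumOver-cong (allFin n) (λ i → sumOver-cong (allVecs n m) (λ u → 𝟙-not-∨ (p (toℕ i)) _)) ⟩
  sumFin n (λ i → sumVec n m (λ u → 𝟙 (not (p (toℕ i))) * 𝟙 (not (any p (indices u)))))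
    ≡⟨ sumOver-product (allFin n) (allVecs n m) _ _ ⟩
  sumFin n (λ i → 𝟙 (not (p (toℕ i)))) * missCount n m p
    ≡⟨ cong₂ _*_ (sumFin-toℕ n _) (missCount-power n m p) ⟩
  sumBelow n (λ x → 𝟙 (not (p x))) ^ suc m  ∎
  where open ≡-Reasoning

hitCount-suc : ∀ n m p → hitCount n (suc m) p ≤ sumBelow n (𝟙 ∘ p) * n ^ m + n * hitCount n m p
hitCount-suc n m p = begin
  hitCount n (suc m) p
    ≤⟨ sumOver-mono (allVecs n (suc m)) (λ { (i ∷ᵥ u) → 𝟙-∨ (p (toℕ i)) (any p (indices u)) }) ⟩
  sumVec n (suc m) (λ u → 𝟙 (p (toℕ (head u))) + 𝟙 (any p (indices (tail u))))
    ≡⟨ sumOver-+ (allVecs n (suc m)) _ _ ⟩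
  sumVec n (suc m) (λ u → 𝟙 (p (toℕ (head u)))) + sumVec n (suc m) (λ u → 𝟙 (any p (indices (tail u))))
    ≡⟨ cong₂ _+_ (sumVec-head n m _) (sumVec-tail n m _) ⟩
  sumFin n (𝟙 ∘ p ∘ toℕ) * n ^ m + n * hitCount n m p
    ≡⟨ cong (λ c → c * n ^ m + n * hitCount n m p) (sumFin-toℕ n (𝟙 ∘ p)) ⟩
  sumBelow n (𝟙 ∘ p) * n ^ m + n * hitCount n m p  ∎
  where open ≤-Reasoning

hitCount-union : ∀ n m p → n * hitCount n m p ≤ m * sumBelow n (𝟙 ∘ p) * n ^ m
hitCount-union n zero    p = ≤-trans (≤-reflexive (*-zeroʳ n)) z≤n
hitCount-union n (suc m) p = begin
  n * hitCount n (suc m) p              ≤⟨ *-monoʳ-≤ n (hitCount-suc n m p) ⟩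
  n * (P * n ^ m + n * hitCount n m p)  ≤⟨ *-monoʳ-≤ n (+-monoʳ-≤ (P * n ^ m) (hitCount-union n m p)) ⟩
  n * (P * n ^ m + m * P * n ^ m)       ≡⟨ regroup n P (n ^ m) m ⟩
  suc m * P * (n * n ^ m)               ∎
  where
  open ≤-Reasoning
  P = sumBelow n (𝟙 ∘ p)
  regroup : ∀ n P N m → n * (P * N + m * P * N) ≡ (1 + m) * P * (n * N)
  regroup = solve-∀

-- Hitting a window

inWindow : ℕ → ℕ → ℕ → Bool
inWindow s w x = (s ≤ᵇ x) ∧ (x <ᵇ s + w)

inWindow-sound : ∀ s w x → T (inWindow s w x) → s ≤ x × x < s + w
inWindow-sound s w x t with Equivalence.to T-∧ t
... | s≤ᵇx , x<ᵇs+w = ≤ᵇ⇒≤ s x s≤ᵇx , <ᵇ⇒< x (s + w) x<ᵇs+w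

window-complement : ∀ s w r → sumBelow (s + w + r) (λ x → 𝟙 (not (inWindow s w x))) ≡ s + r
window-complement s w r = begin
  sumBelow (s + w + r) outside
    ≡⟨ cong (λ n → sumBelow n outside) (+-assoc s w r) ⟩
  sumBelow (s + (w + r)) outside
    ≡⟨ sumBelow-+ s (w + r) outside ⟩
  sumBelow s outside + sumBelow (w + r) (λ i → outside (s + i))
    ≡⟨ cong (sumBelow s outside +_) (sumBelow-+ w r (λ i → outside (s + i))) ⟩
  sumBelow s outside + (sumBelow w (λ i → outside (s + i)) + sumBelow r (λ i → outside (s + (w + i))))
    ≡⟨ cong₂ _+_ (sumBelow-const s 1 outside below) (cong₂ _+_ (sumBelow-const w 0 _ inside) (sumBelow-const r 1 _ above)) ⟩
  s * 1 + (w * 0 + r * 1)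
    ≡⟨ simplify s w r ⟩
  s + r  ∎
  where
  open ≡-Reasoning
  outside : ℕ → ℕ
  outside x = 𝟙 (not (inWindow s w x))
  𝟙-not-false : ∀ {b} → ¬ T b → 𝟙 (not b) ≡ 1
  𝟙-not-false {true}  ¬t = contradiction tt ¬t
  𝟙-not-false {false} _  = refl
  below : ∀ i → i < s → outside i ≡ 1
  below i i<s = 𝟙-not-false (λ t → <⇒≱ i<s (proj₁ (inWindow-sound s w i t)))
  inside : ∀ i → i < w → outside (s + i) ≡ 0
  inside i i<w 
    rewrite Equivalence.to T-≡ (≤⇒≤ᵇ (m≤m+n s i)) | Equivalence.to T-≡ (<⇒<ᵇ (+-monoʳ-< s i<w)) = refl
  above : ∀ i → i < r → outside (s + (w + i)) ≡ 1
  above i _ = 𝟙-not-false (λ t → <⇒≱ (proj₂ (inWindow-sound s w _ t)) (+-monoʳ-≤ s (m≤m+n w i)))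
  simplify : ∀ s w r → s * 1 + (w * 0 + r * 1) ≡ s + r
  simplify = solve-∀

bernoulli : ∀ d w k → d ^ k * (d + w + k * w) ≤ (d + w) ^ suc k
bernoulli d w zero    = ≤-reflexive (base d w)
  where
  base : ∀ d w → 1 * (d + w + 0 * w) ≡ (d + w) * 1
  base = solve-∀
bernoulli d w (suc k) = begin
  d * d ^ k * (d + w + suc k * w)       ≡⟨ regroup d (d ^ k) w k ⟩
  d ^ k * (d * (d + w + w + k * w))     ≤⟨ *-monoʳ-≤ (d ^ k) (m≤m+n _ (w * w + k * w * w)) ⟩
  d ^ k * (d * (d + w + w + k * w) + (w * w + k * w * w))
                                        ≡⟨ factor d (d ^ k) w k ⟩
  (d + w) * (d ^ k * (d + w + k * w))   ≤⟨ *-monoʳ-≤ (d + w) (bernoulli d w k) ⟩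
  (d + w) * (d + w) ^ suc k             ∎
  where
  open ≤-Reasoning
  regroup : ∀ d D w k → d * D * (d + w + (1 + k) * w) ≡ D * (d * (d + w + w + k * w))
  regroup = solve-∀
  factor : ∀ d D w k → D * (d * (d + w + w + k * w) + (w * w + k * w * w)) ≡ (d + w) * (D * (d + w + k * w))
  factor = solve-∀

-- With n = d + w and k w ≥ n / 6, Bernoulli gives (d / n) ^ k ≤ n / (n + k w) ≤ 6 / 7.
7*d^k≤6*[d+w]^k : ∀ d w k → 0 < d + w → d + w ≤ 6 * (k * w) → 7 * d ^ k ≤ 6 * (d + w) ^ k
7*d^k≤6*[d+w]^k d w k 0<n n≤6kw = *-cancelˡ-≤ n {{>-nonZero 0<n}} (begin
  n * (7 * D)                  ≡⟨ split n D ⟩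
  6 * (D * n) + D * n          ≤⟨ +-monoʳ-≤ (6 * (D * n)) (*-monoʳ-≤ D n≤6kw) ⟩
  6 * (D * n) + D * (6 * (k * w))
                               ≡⟨ merge D n k w ⟩
  6 * (D * (n + k * w))        ≤⟨ *-monoʳ-≤ 6 (bernoulli d w k) ⟩
  6 * (n * n ^ k)              ≡⟨ *-left-swap 6 n (n ^ k) ⟩
  n * (6 * n ^ k)              ∎)
  where
  open ≤-Reasoning
  n = d + w
  D = d ^ k
  split : ∀ n D → n * (7 * D) ≡ 6 * (D * n) + D * n
  split = solve-∀
  merge : ∀ D n k w → 6 * (D * n) + D * (6 * (k * w)) ≡ 6 * (D * (n + k * w))
  merge = solve-∀

hitCount-window : ∀ {n} s w k → 0 < n → s + w ≤ n → n ≤ 6 * (k * w) →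
                  n ^ k ≤ 7 * hitCount n k (inWindow s w)
hitCount-window {n} s w k 0<n s+w≤n n≤6kw with m≤n⇒∃[o]m+o≡n s+w≤n
... | r , refl = +-cancelʳ-≤ (6 * n ^ k) (n ^ k) _ (begin
  7 * n ^ k                 ≡⟨ cong (7 *_) (hitCount+missCount n k (inWindow s w)) ⟨
  7 * (H + M)               ≡⟨ *-distribˡ-+ 7 H M ⟩
  7 * H + 7 * M             ≡⟨ cong (λ x → 7 * H + 7 * x) miss≡ ⟩
  7 * H + 7 * (s + r) ^ k   ≤⟨ +-monoʳ-≤ (7 * H) (7*d^k≤6*[d+w]^k (s + r) w k (subst (0 <_) n≡d+w 0<n) (subst (_≤ 6 * (k * w)) n≡d+w n≤6kw)) ⟩
  7 * H + 6 * (s + r + w) ^ k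
                            ≡⟨ cong (λ x → 7 * H + 6 * x ^ k) n≡d+w ⟨
  7 * H + 6 * n ^ k         ∎)
  where
  open ≤-Reasoning
  H = hitCount n k (inWindow s w)
  M = missCount n k (inWindow s w)
  n≡d+w : s + w + r ≡ s + r + w
  n≡d+w = +-right-swap s w r
    where
    +-right-swap : ∀ a b c → a + b + c ≡ a + c + b
    +-right-swap = solve-∀
  miss≡ : M ≡ (s + r) ^ k
  miss≡ = trans (missCount-power n k (inWindow s w)) (cong (_^ k) (window-complement s w r))

-- Marginalisation over operation types

opposite : Op → Op
opposite upd = qry
opposite qry = upd

length≡countOp+countOp : ∀ o ops → length ops ≡ countOp (opposite o) ops + countOp o ops
length≡countOp+countOp o   []          = refl
length≡countOp+countOp upd (upd ∷ ops) = trans (cong suc (length≡countOp+countOp upd ops)) (sym (+-suc _ _))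
length≡countOp+countOp qry (qry ∷ ops) = trans (cong suc (length≡countOp+countOp qry ops)) (sym (+-suc _ _))
length≡countOp+countOp upd (qry ∷ ops) = cong suc (length≡countOp+countOp upd ops)
length≡countOp+countOp qry (upd ∷ ops) = cong suc (length≡countOp+countOp qry ops)

countOp≤length : ∀ o ops → countOp o ops ≤ length ops
countOp≤length o ops = subst (countOp o ops ≤_) (sym (length≡countOp+countOp o ops)) (m≤n+m _ _)

Marginal : ℕ → Op → List Op → Set
Marginal n o ops = ∀ (F : List ℕ → ℕ) →
  sumVec n (length ops) (F ∘ touched o ops) ≡ n ^ countOp (opposite o) ops * sumVec n (countOp o ops) (F ∘ indices)

marginal-[] : ∀ n o → Marginal n o []
marginal-[] n o F = trans (sumVec-zero n (F ∘ touched o [])) (sym (trans (*-identityˡ _) (sumVec-zero n (F ∘ indices))))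

module _ (n : ℕ) (o : Op) (ops : List Op) (marginal : Marginal n o ops) (F : List ℕ → ℕ) where

  private
    c = countOp o ops
    c′ = countOp (opposite o) ops

  marginal-touch : sumFin n (λ i → sumVec n (length ops) (λ v → F (toℕ i ∷ touched o ops v)))
                   ≡ n ^ c′ * sumVec n (suc c) (F ∘ indices)
  marginal-touch = begin
    sumFin n (λ i → sumVec n (length ops) (λ v → F (toℕ i ∷ touched o ops v)))
      ≡⟨ sumOver-cong (allFin n) (λ i → marginal (λ xs → F (toℕ i ∷ xs))) ⟩
    sumFin n (λ i → n ^ c′ * sumVec n c (λ u → F (toℕ i ∷ indices u)))
      ≡⟨ sumOver-*ˡ (allFin n) (n ^ c′) _ ⟩
    n ^ c′ * sumFin n (λ i → sumVec n c (λ u → F (indices (i ∷ᵥ u))))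
      ≡⟨ cong (n ^ c′ *_) (sumVec-suc n c (F ∘ indices)) ⟨
    n ^ c′ * sumVec n (suc c) (F ∘ indices)  ∎
    where open ≡-Reasoning

  marginal-skip : sumFin n (λ _ → sumVec n (length ops) (F ∘ touched o ops))
                  ≡ n ^ suc c′ * sumVec n c (F ∘ indices)
  marginal-skip = begin
    sumFin n (λ _ → sumVec n (length ops) (F ∘ touched o ops))  ≡⟨ sumFin-const n _ ⟩
    n * sumVec n (length ops) (F ∘ touched o ops)               ≡⟨ cong (n *_) (marginal F) ⟩
    n * (n ^ c′ * sumVec n c (F ∘ indices))                     ≡⟨ *-assoc n _ _ ⟨
    n ^ suc c′ * sumVec n c (F ∘ indices)                       ∎
    where open ≡-Reasoning

marginal : ∀ n o ops → Marginal n o ops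
marginal n o   []          = marginal-[] n o
marginal n upd (upd ∷ ops) F = trans (sumVec-suc n _ _) (marginal-touch n upd ops (marginal n upd ops) F)
marginal n qry (qry ∷ ops) F = trans (sumVec-suc n _ _) (marginal-touch n qry ops (marginal n qry ops) F)
marginal n upd (qry ∷ ops) F = trans (sumVec-suc n _ _) (marginal-skip n upd ops (marginal n upd ops) F)
marginal n qry (upd ∷ ops) F = trans (sumVec-suc n _ _) (marginal-skip n qry ops (marginal n qry ops) F)

sumInterleaving₀ : (n p q : ℕ) → ℕ
sumInterleaving₀ n p q =
  sumVec n p (λ a → sumVec n q (λ b → interleaveCount (sort (indices a)) (sort (indices b))))

sumInterleaving-marginal : ∀ n left right → sumInterleaving n left right ≡
  n ^ (countOp qry left + countOp upd right) * sumInterleaving₀ n (countOp upd left) (countOp qry right)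
sumInterleaving-marginal n left right = begin
  sumInterleaving n left right
    ≡⟨ sumVec-split n (length left) (length right) (λ u v → G (touched upd left u) (touched qry right v)) ⟩
  sumVec n (length left) (λ u → sumVec n (length right) (G (touched upd left u) ∘ touched qry right))
    ≡⟨ sumOver-cong (allVecs n (length left)) (λ u → marginal n qry right (G (touched upd left u))) ⟩
  sumVec n (length left) (λ u → n ^ oR * sumVec n cR (G (touched upd left u) ∘ indices))
    ≡⟨ sumOver-*ˡ (allVecs n (length left)) (n ^ oR) _ ⟩
  n ^ oR * sumVec n (length left) (λ u → sumVec n cR (G (touched upd left u) ∘ indices))
    ≡⟨ cong (n ^ oR *_) (marginal n upd left (λ A → sumVec n cR (G A ∘ indices))) ⟩
  n ^ oR * (n ^ oL * sumInterleaving₀ n cL cR)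
    ≡⟨ *-assoc (n ^ oR) _ _ ⟨
  n ^ oR * n ^ oL * sumInterleaving₀ n cL cR
    ≡⟨ cong (_* sumInterleaving₀ n cL cR) (trans (*-comm (n ^ oR) _) (sym (^-distribˡ-+-* n oL oR))) ⟩
  n ^ (oL + oR) * sumInterleaving₀ n cL cR  ∎
  where
  open ≡-Reasoning
  G : List ℕ → List ℕ → ℕ
  G A B = interleaveCount (sort A) (sort B)
  oL = countOp qry left
  cL = countOp upd left
  oR = countOp upd right
  cR = countOp qry right

interleaveCount≤length : ∀ as bs → interleaveCount as bs ≤ length as
interleaveCount≤length []           bs = z≤n
interleaveCount≤length (x ∷ [])     bs = z≤n
interleaveCount≤length (x ∷ y ∷ as) bs = +-mono-≤ (𝟙≤1 _) (interleaveCount≤length (y ∷ as) bs)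

length-indices : ∀ {n m} (u : Vec (Fin n) m) → length (indices u) ≡ m
length-indices u = trans (length-map toℕ (toList u)) (length-toList u)

sumInterleaving₀-upper : ∀ n p q → sumInterleaving₀ n p q ≤ p * n ^ (p + q)
sumInterleaving₀-upper n p q = begin
  sumInterleaving₀ n p q
    ≤⟨ sumOver-mono (allVecs n p) (λ a → sumOver-mono (allVecs n q) (λ b → ≤-trans
         (interleaveCount≤length (sort (indices a)) _)
         (≤-reflexive (trans (↭-length (sort-↭ (indices a))) (length-indices a))))) ⟩
  sumVec n p (λ _ → sumVec n q (λ _ → p))
    ≡⟨ sumOver-cong (allVecs n p) (λ _ → sumVec-const n q p) ⟩
  sumVec n p (λ _ → p * n ^ q)
    ≡⟨ sumVec-const n p (p * n ^ q) ⟩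
  p * n ^ q * n ^ p
    ≡⟨ regroup p (n ^ q) (n ^ p) ⟩
  p * (n ^ p * n ^ q)
    ≡⟨ cong (p *_) (^-distribˡ-+-* n p q) ⟨
  p * n ^ (p + q)  ∎
  where
  open ≤-Reasoning
  regroup : ∀ a b c → a * b * c ≡ a * (c * b)
  regroup = solve-∀

-- Interleaving patterns

data Interleaved (A B : List ℕ) : ℕ → ℕ → Set where
  done : ∀ {lo} → Interleaved A B lo 0
  next : ∀ {lo x y z c} → lo ≤ x → x < y → y < z → x ∈ A → y ∈ B → z ∈ A →
         Interleaved A B z c → Interleaved A B lo (suc c)

Interleaved-weaken : ∀ {A B lo lo′ c} → lo′ ≤ lo → Interleaved A B lo c → Interleaved A B lo′ c
Interleaved-weaken lo′≤lo done                              = done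
Interleaved-weaken lo′≤lo (next lo≤x x<y y<z x∈ y∈ z∈ rest) = next (≤-trans lo′≤lo lo≤x) x<y y<z x∈ y∈ z∈ rest

∈-tail : ∀ {u x : ℕ} {A} → u < x → x ∈ u ∷ A → x ∈ A
∈-tail u<x (here refl) = contradiction u<x (<-irrefl refl)
∈-tail u<x (there x∈A) = x∈A

Interleaved-tail : ∀ {u A B lo c} → u < lo → Interleaved (u ∷ A) B lo c → Interleaved A B lo c
Interleaved-tail u<lo done = done
Interleaved-tail u<lo (next lo≤x x<y y<z x∈ y∈ z∈ rest) =
  next lo≤x x<y y<z (∈-tail u<x x∈) y∈ (∈-tail u<z z∈) (Interleaved-tail u<z rest)
  where
  u<x = <-≤-trans u<lo lo≤x
  u<z = <-trans u<x (<-trans x<y y<z)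

≤⇒≤ᵇ' : ∀ {y v} → y ≤ v → T (y ≤ᵇ' v)
≤⇒≤ᵇ' {y} {v} y≤v with m≤n⇒m<n∨m≡n y≤v
... | inj₁ y<v = Equivalence.from T-∨ (inj₁ (<⇒<ᵇ y<v))
... | inj₂ y≡v = Equivalence.from T-∨ (inj₂ (≡⇒≡ᵇ y v y≡v))

head≤ : ∀ {u x : ℕ} {A} → All (u ≤_) A → x ∈ u ∷ A → u ≤ x
head≤ u≤A (here refl) = ≤-refl
head≤ u≤A (there x∈A) = All.lookup u≤A x∈A

suc≤𝟙+ : ∀ {b c k} → T b → c ≤ k → suc c ≤ 𝟙 b + k
suc≤𝟙+ {true} _ c≤k = s≤s c≤k

-- Each pattern x < y < z yields a gap a_i < y ≤ a_{i+1} of the sorted A, and the gaps of distinct patterns are distinct.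
interleaveCount-≥ : ∀ {A B lo c} → AllPairs _≤_ A → Interleaved A B lo c → c ≤ interleaveCount A B
interleaveCount-≥ _ done = z≤n
interleaveCount-≥ {[]}    _ (next _ _ _ () _ _ _)
interleaveCount-≥ {_ ∷ []} _ (next _ x<y y<z (here refl) _ (here refl) _) = contradiction (<-trans x<y y<z) (<-irrefl refl)
interleaveCount-≥ {_ ∷ []} _ (next _ _ _ (there ()) _ _ _)
interleaveCount-≥ {_ ∷ []} _ (next _ _ _ _ _ (there ()) _)
interleaveCount-≥ {u ∷ v ∷ A} (u≤A ∷ sorted) (next {y = y} _ x<y y<z x∈ y∈ z∈ rest) with y ≤? v
... | yes y≤v = suc≤𝟙+ (any⁺ _ (lose y∈ (Equivalence.from T-∧ (<⇒<ᵇ u<y , ≤⇒≤ᵇ' y≤v))))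
                       (interleaveCount-≥ sorted (Interleaved-tail (<-trans u<y y<z) rest))
  where u<y = ≤-<-trans (head≤ u≤A x∈) x<y
... | no y≰v = ≤-trans (interleaveCount-≥ sorted (next ≤-refl (≰⇒> y≰v) y<z (here refl) y∈ (∈-tail u<z z∈) (Interleaved-tail u<z rest)))
                       (m≤n+m _ _)
  where u<z = <-trans (≤-<-trans (head≤ u≤A x∈) x<y) y<z

blockHit : (w s : ℕ) (xs ys bs : List ℕ) → ℕ
blockHit w s xs ys bs =
  𝟙 (any (inWindow s w) xs) * 𝟙 (any (inWindow (s + w + w) w) ys) * 𝟙 (any (inWindow (s + w) w) bs)

blockHits : (w c s : ℕ) (xs ys bs : List ℕ) → ℕ
blockHits w zero    s xs ys bs = 0
blockHits w (suc c) s xs ys bs = blockHit w s xs ys bs + blockHits w c (s + w + w + w) xs ys bs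

Interleaved-if : ∀ {A B lo c} p q r → (T p → T q → T r → Interleaved A B lo (suc c)) →
                 Interleaved A B lo c → Interleaved A B lo (𝟙 p * 𝟙 q * 𝟙 r + c)
Interleaved-if true  true  true  extend _ = extend tt tt tt
Interleaved-if false _     _     _ rest = rest
Interleaved-if true  false _     _ rest = rest
Interleaved-if true  true  false _ rest = rest

∈-window : ∀ s w xs → T (any (inWindow s w) xs) → Σ ℕ (λ x → x ∈ xs × s ≤ x × x < s + w)
∈-window s w xs hit with find (any⁻ (inWindow s w) xs hit)
... | x , x∈ , t = x , x∈ , inWindow-sound s w x t

∈-sort : ∀ {x} xs → x ∈ xs → x ∈ sort xs
∈-sort xs = ∈-resp-↭ (↭-sym (sort-↭ xs))

blockHits-interleaved : ∀ w c s xs ys bs → Interleaved (sort (xs ++ ys)) (sort bs) s (blockHits w c s xs ys bs)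
blockHits-interleaved w zero    s xs ys bs = done
blockHits-interleaved w (suc c) s xs ys bs =
  Interleaved-if (any (inWindow s w) xs) (any (inWindow (s + w + w) w) ys) (any (inWindow (s + w) w) bs) extend
                 (Interleaved-weaken s≤s+3w rest)
  where
  rest = blockHits-interleaved w c (s + w + w + w) xs ys bs
  s≤s+3w = ≤-trans (m≤m+n s w) (≤-trans (m≤m+n (s + w) w) (m≤m+n (s + w + w) w))
  extend : _ → _ → _ → Interleaved (sort (xs ++ ys)) (sort bs) s (suc (blockHits w c (s + w + w + w) xs ys bs))
  extend hx hz hy with ∈-window s w xs hx | ∈-window (s + w + w) w ys hz | ∈-window (s + w) w bs hy
  ... | x , x∈ , s≤x , x< | z , z∈ , z≥ , z< | y , y∈ , y≥ , y< =
    next s≤x (<-≤-trans x< y≥) (<-≤-trans y< z≥) (∈-sort (xs ++ ys) (∈-++⁺ˡ x∈)) (∈-sort bs y∈)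
         (∈-sort (xs ++ ys) (∈-++⁺ʳ xs z∈)) (Interleaved-weaken (<⇒≤ z<) rest)

blockHits≤interleaveCount : ∀ w c xs ys bs → blockHits w c 0 xs ys bs ≤ interleaveCount (sort (xs ++ ys)) (sort bs)
blockHits≤interleaveCount w c xs ys bs =
  interleaveCount-≥ (Linked⇒AllPairs ≤-trans (sort-↗ (xs ++ ys))) (blockHits-interleaved w c 0 xs ys bs)

sum3 : (n h r q : ℕ) → (List ℕ → List ℕ → List ℕ → ℕ) → ℕ
sum3 n h r q F = sumVec n h (λ u → sumVec n r (λ v → sumVec n q (λ b → F (indices u) (indices v) (indices b))))

sum3-+ : ∀ n h r q F G → sum3 n h r q (λ xs ys bs → F xs ys bs + G xs ys bs) ≡ sum3 n h r q F + sum3 n h r q G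
sum3-+ n h r q F G = begin
  sumVec n h (λ u → sumVec n r (λ v → sumVec n q (λ b → F′ u v b + G′ u v b)))
    ≡⟨ sumOver-cong (allVecs n h) (λ u → sumOver-cong (allVecs n r) (λ v → sumOver-+ (allVecs n q) (F′ u v) (G′ u v))) ⟩
  sumVec n h (λ u → sumVec n r (λ v → sumVec n q (F′ u v) + sumVec n q (G′ u v)))
    ≡⟨ sumOver-cong (allVecs n h) (λ u → sumOver-+ (allVecs n r) _ _) ⟩
  sumVec n h (λ u → sumVec n r (λ v → sumVec n q (F′ u v)) + sumVec n r (λ v → sumVec n q (G′ u v)))
    ≡⟨ sumOver-+ (allVecs n h) _ _ ⟩
  sum3 n h r q F + sum3 n h r q G  ∎
  where
  open ≡-Reasoning
  F′ G′ : Vec (Fin n) h → Vec (Fin n) r → Vec (Fin n) q → ℕ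
  F′ u v b = F (indices u) (indices v) (indices b)
  G′ u v b = G (indices u) (indices v) (indices b)

sum3-product : ∀ n h r q f g k → sum3 n h r q (λ xs ys bs → f xs * g ys * k bs) ≡
               sumVec n h (f ∘ indices) * sumVec n r (g ∘ indices) * sumVec n q (k ∘ indices)
sum3-product n h r q f g k = begin
  sumVec n h (λ u → sumVec n r (λ v → sumVec n q (λ b → f′ u * g′ v * k′ b)))
    ≡⟨ sumOver-cong (allVecs n h) (λ u → sumOver-cong (allVecs n r) (λ v → sumOver-*ˡ (allVecs n q) (f′ u * g′ v) k′)) ⟩
  sumVec n h (λ u → sumVec n r (λ v → f′ u * g′ v * K))
    ≡⟨ sumOver-cong (allVecs n h) (λ u → sumOver-*ʳ (allVecs n r) K _) ⟩
  sumVec n h (λ u → sumVec n r (λ v → f′ u * g′ v) * K)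
    ≡⟨ sumOver-*ʳ (allVecs n h) K _ ⟩
  sumVec n h (λ u → sumVec n r (λ v → f′ u * g′ v)) * K
    ≡⟨ cong (_* K) (sumOver-product (allVecs n h) (allVecs n r) f′ g′) ⟩
  sumVec n h f′ * sumVec n r g′ * K  ∎
  where
  open ≡-Reasoning
  f′ = f ∘ indices {n} {h}
  g′ = g ∘ indices {n} {r}
  k′ = k ∘ indices {n} {q}
  K = sumVec n q k′

module _ {n w h r q : ℕ} (0<n : 0 < n) (h≤r : h ≤ r) (h≤q : h ≤ q) (n≤6hw : n ≤ 6 * (h * w)) where

  private
    n≤6kw : ∀ {k} → h ≤ k → n ≤ 6 * (k * w)
    n≤6kw h≤k = ≤-trans n≤6hw (*-monoʳ-≤ 6 (*-monoˡ-≤ w h≤k))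

  blockHit-sum : ∀ s → s + w + w + w ≤ n → n ^ (h + r + q) ≤ 343 * sum3 n h r q (blockHit w s)
  blockHit-sum s fits = begin
    n ^ (h + r + q)                 ≡⟨ trans (^-distribˡ-+-* n (h + r) q) (cong (_* n ^ q) (^-distribˡ-+-* n h r)) ⟩
    n ^ h * n ^ r * n ^ q           ≤⟨ *-mono-≤ (*-mono-≤ (hitCount-window s w h 0<n x-fits (n≤6kw ≤-refl))
                                                           (hitCount-window (s + w + w) w r 0<n fits (n≤6kw h≤r)))
                                                (hitCount-window (s + w) w q 0<n y-fits (n≤6kw h≤q)) ⟩
    7 * X * (7 * Z) * (7 * Y)       ≡⟨ regroup X Z Y ⟩
    343 * (X * Z * Y)               ≡⟨ cong (343 *_) (sum3-product n h r q (hits s) (hits (s + w + w)) (hits (s + w))) ⟨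
    343 * sum3 n h r q (blockHit w s)  ∎
    where
    open ≤-Reasoning
    hits : ℕ → List ℕ → ℕ
    hits t xs = 𝟙 (any (inWindow t w) xs)
    X = hitCount n h (inWindow s w)
    Y = hitCount n q (inWindow (s + w) w)
    Z = hitCount n r (inWindow (s + w + w) w)
    y-fits = ≤-trans (m≤m+n (s + w + w) w) fits
    x-fits = ≤-trans (m≤m+n (s + w) w) y-fits
    regroup : ∀ a b c → 7 * a * (7 * b) * (7 * c) ≡ 343 * (a * b * c)
    regroup = solve-∀

  blockHits-sum : ∀ c s → s + c * (w + w + w) ≤ n → c * n ^ (h + r + q) ≤ 343 * sum3 n h r q (blockHits w c s)
  blockHits-sum zero    s _    = z≤n
  blockHits-sum (suc c) s fits = begin
    n ^ (h + r + q) + c * n ^ (h + r + q)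
      ≤⟨ +-mono-≤ (blockHit-sum s (≤-trans (m≤m+n _ (c * (w + w + w))) fits′)) (blockHits-sum c (s + w + w + w) fits′) ⟩
    343 * sum3 n h r q (blockHit w s) + 343 * sum3 n h r q (blockHits w c (s + w + w + w))
      ≡⟨ *-distribˡ-+ 343 (sum3 n h r q (blockHit w s)) (sum3 n h r q (blockHits w c (s + w + w + w))) ⟨
    343 * (sum3 n h r q (blockHit w s) + sum3 n h r q (blockHits w c (s + w + w + w)))
      ≡⟨ cong (343 *_) (sum3-+ n h r q (blockHit w s) (blockHits w c (s + w + w + w))) ⟨
    343 * sum3 n h r q (blockHits w (suc c) s)  ∎
    where
    open ≤-Reasoning
    fits′ : s + w + w + w + c * (w + w + w) ≤ n
    fits′ = subst (_≤ n) (reassoc s w c) fits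
      where
      reassoc : ∀ s w c → s + (1 + c) * (w + w + w) ≡ s + w + w + w + c * (w + w + w)
      reassoc = solve-∀

indices-++ : ∀ {n p q} (u : Vec (Fin n) p) (v : Vec (Fin n) q) → indices (u ++ᵥ v) ≡ indices u ++ indices v
indices-++ u v = trans (cong (map toℕ) (toList-++ u v)) (map-++ toℕ (toList u) (toList v))

sum3≤sumInterleaving₀ : ∀ n h r q w c → sum3 n h r q (blockHits w c 0) ≤ sumInterleaving₀ n (h + r) q
sum3≤sumInterleaving₀ n h r q w c = begin
  sum3 n h r q (blockHits w c 0)
    ≤⟨ sumOver-mono (allVecs n h) (λ u → sumOver-mono (allVecs n r) (λ v → sumOver-mono (allVecs n q) (λ b →
         blockHits≤interleaveCount w c (indices u) (indices v) (indices b)))) ⟩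
  sumVec n h (λ u → sumVec n r (λ v → sumVec n q (λ b → interleaveCount (sort (indices u ++ indices v)) (sort (indices b)))))
    ≡⟨ sumOver-cong (allVecs n h) (λ u → sumOver-cong (allVecs n r) (λ v →
         cong (λ A → sumVec n q (λ b → interleaveCount (sort A) (sort (indices b)))) (indices-++ u v))) ⟨
  sumVec n h (λ u → sumVec n r (λ v → G (u ++ᵥ v)))
    ≡⟨ sumVec-++ n h r G ⟨
  sumInterleaving₀ n (h + r) q  ∎
  where
  open ≤-Reasoning
  G : Vec (Fin n) (h + r) → ℕ
  G a = sumVec n q (λ b → interleaveCount (sort (indices a)) (sort (indices b)))

n≤2*[q*[n/q]] : ∀ n q .{{_ : NonZero q}} → q ≤ n → n ≤ 2 * (q * (n / q))
n≤2*[q*[n/q]] n q q≤n = begin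
  n                          ≡⟨ m≡m%n+[m/n]*n n q ⟩
  n % q + n / q * q          ≤⟨ +-monoˡ-≤ (n / q * q) (<⇒≤ (m%n<n n q)) ⟩
  q + n / q * q              ≤⟨ +-monoˡ-≤ (n / q * q) (m≤n*m q (n / q) {{>-nonZero (m≥n⇒m/n>0 q≤n)}}) ⟩
  n / q * q + n / q * q      ≡⟨ double (n / q) q ⟩
  2 * (q * (n / q))          ∎
  where
  open ≤-Reasoning
  double : ∀ a b → a * b + a * b ≡ 2 * (b * a)
  double = solve-∀

⌈n/2⌉≤1+⌊n/2⌋ : ∀ n → ⌈ n /2⌉ ≤ suc ⌊ n /2⌋
⌈n/2⌉≤1+⌊n/2⌋ zero          = z≤n
⌈n/2⌉≤1+⌊n/2⌋ (suc zero)    = s≤s z≤n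
⌈n/2⌉≤1+⌊n/2⌋ (suc (suc n)) = s≤s (⌈n/2⌉≤1+⌊n/2⌋ n)

sumInterleaving₀-lower : ∀ n L → 2 ≤ L → L + L ≤ n → L * n ^ (L + L) ≤ 1029 * sumInterleaving₀ n L L
sumInterleaving₀-lower n 1 (s≤s ()) _
sumInterleaving₀-lower n L@(suc (suc k)) _ 2L≤n = begin
  L * n ^ (L + L)                     ≤⟨ *-monoˡ-≤ (n ^ (L + L)) L≤3h ⟩
  3 * h * n ^ (L + L)                 ≡⟨ *-assoc 3 h _ ⟩
  3 * (h * n ^ (L + L))               ≤⟨ *-monoʳ-≤ 3 patterns ⟩
  3 * (343 * sumInterleaving₀ n L L)  ≡⟨ *-assoc 3 343 (sumInterleaving₀ n L L) ⟨
  1029 * sumInterleaving₀ n L L       ∎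
  where
  open ≤-Reasoning
  h = ⌊ L /2⌋
  r = ⌈ L /2⌉
  h+r≡L : h + r ≡ L
  h+r≡L = ⌊n/2⌋+⌈n/2⌉≡n L
  h≤r : h ≤ r
  h≤r = ⌊n/2⌋≤⌈n/2⌉ L
  h+h≤L : h + h ≤ L
  h+h≤L = subst (h + h ≤_) h+r≡L (+-monoʳ-≤ h h≤r)
  h≤L : h ≤ L
  h≤L = ≤-trans (m≤m+n h h) h+h≤L
  L≤3h : L ≤ 3 * h
  L≤3h = subst (_≤ 3 * h) h+r≡L (≤-trans (+-monoʳ-≤ h (⌈n/2⌉≤1+⌊n/2⌋ L)) (2h+1≤3h ⌊ k /2⌋))
    where
    2h+1≤3h : ∀ x → suc x + suc (suc x) ≤ 3 * suc x
    2h+1≤3h x = subst (suc x + suc (suc x) ≤_) (regroup x) (m≤m+n _ x)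
      where
      regroup : ∀ x → (1 + x) + (2 + x) + x ≡ 3 * (1 + x)
      regroup = solve-∀
  3h≤n : 3 * h ≤ n
  3h≤n = ≤-trans (≤-reflexive (three-times h)) (≤-trans (+-mono-≤ h+h≤L h≤L) 2L≤n)
    where
    three-times : ∀ h → 3 * h ≡ h + h + h
    three-times = solve-∀
  w = n / (3 * h)
  n≤6hw : n ≤ 6 * (h * w)
  n≤6hw = subst (n ≤_) (regroup h w) (n≤2*[q*[n/q]] n (3 * h) 3h≤n)
    where
    regroup : ∀ h w → 2 * (3 * h * w) ≡ 6 * (h * w)
    regroup = solve-∀
  fits : 0 + h * (w + w + w) ≤ n
  fits = subst (_≤ n) (regroup w h) (m/n*n≤m n (3 * h))
    where
    regroup : ∀ w h → w * (3 * h) ≡ 0 + h * (w + w + w)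
    regroup = solve-∀
  0<n : 0 < n
  0<n = ≤-trans (s≤s z≤n) 2L≤n
  patterns : h * n ^ (L + L) ≤ 343 * sumInterleaving₀ n L L
  patterns = subst (λ m → h * n ^ (m + L) ≤ 343 * sumInterleaving₀ n m L) h+r≡L
    (≤-trans (blockHits-sum 0<n h≤r h≤L n≤6hw h 0 fits) (*-monoʳ-≤ 343 (sum3≤sumInterleaving₀ n h r L w h)))

-- Collisions

dupCount : (n m : ℕ) → ℕ
dupCount n m = sumVec n m (λ u → 𝟙 (hasDup (indices u)))

length-filter≡sumOver : ∀ (p : A → Bool) xs → length (filter (λ x → T? (p x)) xs) ≡ sumOver xs (𝟙 ∘ p)
length-filter≡sumOver p []       = refl
length-filter≡sumOver p (x ∷ xs) with p x
... | true  = cong suc (length-filter≡sumOver p xs)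
... | false = length-filter≡sumOver p xs

collisionCount≡dupCount : ∀ n left right → collisionCount n left right ≡ dupCount n (length left + length right)
collisionCount≡dupCount n left right =
  length-filter≡sumOver (λ ω → hasDup (indices ω)) (allVecs n (length left + length right))

equalCount≤1 : ∀ n x → sumBelow n (λ y → 𝟙 (x ≡ᵇ y)) ≤ 1
equalCount≤1 zero    x       = z≤n
equalCount≤1 (suc n) zero    = s≤s (≤-reflexive (trans (sumBelow-const n 0 _ (λ _ _ → refl)) (*-zeroʳ n)))
equalCount≤1 (suc n) (suc x) = equalCount≤1 n x

dupCount-suc : ∀ n m → dupCount n (suc m) ≤ sumFin n (λ i → hitCount n m (toℕ i ≡ᵇ_)) + n * dupCount n m
dupCount-suc n m = begin
  dupCount n (suc m)
    ≡⟨ sumVec-suc n m _ ⟩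
  sumFin n (λ i → sumVec n m (λ u → 𝟙 (any (toℕ i ≡ᵇ_) (indices u) ∨ hasDup (indices u))))
    ≤⟨ sumOver-mono (allFin n) (λ i → sumOver-mono (allVecs n m) (λ u → 𝟙-∨ (any (toℕ i ≡ᵇ_) (indices u)) _)) ⟩
  sumFin n (λ i → sumVec n m (λ u → 𝟙 (any (toℕ i ≡ᵇ_) (indices u)) + 𝟙 (hasDup (indices u))))
    ≡⟨ sumOver-cong (allFin n) (λ i → sumOver-+ (allVecs n m) _ _) ⟩
  sumFin n (λ i → hitCount n m (toℕ i ≡ᵇ_) + dupCount n m)
    ≡⟨ sumOver-+ (allFin n) _ _ ⟩
  sumFin n (λ i → hitCount n m (toℕ i ≡ᵇ_)) + sumFin n (λ _ → dupCount n m)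
    ≡⟨ cong (sumFin n (λ i → hitCount n m (toℕ i ≡ᵇ_)) +_) (sumFin-const n _) ⟩
  sumFin n (λ i → hitCount n m (toℕ i ≡ᵇ_)) + n * dupCount n m  ∎
  where open ≤-Reasoning

dupCount-bound : ∀ n m → n * dupCount n m ≤ m * m * n ^ m
dupCount-bound n zero    = ≤-trans (≤-reflexive (*-zeroʳ n)) z≤n
dupCount-bound n (suc m) = begin
  n * dupCount n (suc m)
    ≤⟨ *-monoʳ-≤ n (dupCount-suc n m) ⟩
  n * (sumFin n (λ i → hitCount n m (toℕ i ≡ᵇ_)) + n * dupCount n m)
    ≡⟨ *-distribˡ-+ n _ _ ⟩
  n * sumFin n (λ i → hitCount n m (toℕ i ≡ᵇ_)) + n * (n * dupCount n m)
    ≡⟨ cong (_+ n * (n * dupCount n m)) (sumOver-*ˡ (allFin n) n _) ⟨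
  sumFin n (λ i → n * hitCount n m (toℕ i ≡ᵇ_)) + n * (n * dupCount n m)
    ≤⟨ +-mono-≤ (sumOver-mono (allFin n) single) (*-monoʳ-≤ n (dupCount-bound n m)) ⟩
  sumFin n (λ _ → m * n ^ m) + n * (m * m * n ^ m)
    ≡⟨ cong (_+ n * (m * m * n ^ m)) (sumFin-const n _) ⟩
  n * (m * n ^ m) + n * (m * m * n ^ m)
    ≤⟨ m≤m+n _ (suc m * (n * n ^ m)) ⟩
  n * (m * n ^ m) + n * (m * m * n ^ m) + suc m * (n * n ^ m)
    ≡⟨ regroup n (n ^ m) m ⟩
  suc m * suc m * (n * n ^ m)  ∎
  where
  open ≤-Reasoning
  single : ∀ i → n * hitCount n m (toℕ i ≡ᵇ_) ≤ m * n ^ m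
  single i = ≤-trans (hitCount-union n m (toℕ i ≡ᵇ_))
                     (≤-trans (*-monoˡ-≤ (n ^ m) (*-monoʳ-≤ m (equalCount≤1 n (toℕ i))))
                              (≤-reflexive (cong (_* n ^ m) (*-identityʳ m))))
  regroup : ∀ n N m → n * (m * N) + n * (m * m * N) + (1 + m) * (n * N) ≡ (1 + m) * (1 + m) * (n * N)
  regroup = solve-∀

x³≤Kn²⇒x≤n : ∀ {x K n} → K < n → x ^ 3 ≤ K * (n * n) → x ≤ n
x³≤Kn²⇒x≤n {x} {K} {n} K<n x³≤Kn² = ≮⇒≥ λ n<x → <-irrefl refl (begin-strict
  n * (n * n)          <⟨ *-mono-< n<x (*-mono-< n<x n<x) ⟩
  x * (x * x)          ≡⟨ cong (λ y → x * (x * y)) (*-identityʳ x) ⟨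
  x ^ 3                ≤⟨ x³≤Kn² ⟩
  K * (n * n)          <⟨ *-monoˡ-< (n * n) {{m*n≢0 n n}} K<n ⟩
  n * (n * n)          ∎)
  where
  open ≤-Reasoning
  instance
    n≢0 : NonZero n
    n≢0 = >-nonZero (≤-<-trans z≤n K<n)

m³≤Cn⇒m≤n : ∀ {C n m} → C < n → m ^ 3 ≤ C * n → m ≤ n
m³≤Cn⇒m≤n {C} {n} C<n m³≤Cn = x³≤Kn²⇒x≤n C<n (≤-trans m³≤Cn (*-monoʳ-≤ C (m≤m*n n n {{>-nonZero (≤-<-trans z≤n C<n)}})))

m³≤Cn⇒e*m²≤n : ∀ {C e n m} → e * e * e * (C * C) < n → m ^ 3 ≤ C * n → e * (m * m) ≤ n
m³≤Cn⇒e*m²≤n {C} {e} {n} {m} K<n m³≤Cn = x³≤Kn²⇒x≤n K<n (begin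
  (e * (m * m)) ^ 3                 ≡⟨ expand e m ⟩
  e * e * e * (m ^ 3 * m ^ 3)       ≤⟨ *-monoʳ-≤ (e * e * e) (*-mono-≤ m³≤Cn m³≤Cn) ⟩
  e * e * e * (C * n * (C * n))     ≡⟨ regroup e C n ⟩
  e * e * e * (C * C) * (n * n)     ∎)
  where
  open ≤-Reasoning
  expand : ∀ e m → let x = e * (m * m) ; m³ = m * (m * (m * 1)) in x * (x * (x * 1)) ≡ e * e * e * (m³ * m³)
  expand = solve-∀
  regroup : ∀ e C n → e * e * e * (C * n * (C * n)) ≡ e * e * e * (C * C) * (n * n)
  regroup = solve-∀

sumInterleaving-Θ : ∀ {C} n left right L → suc C ≤ n → countOp upd left ≡ L → countOp qry right ≡ L →
  (length left + length right) ^ 3 ≤ C * n →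
  (sumInterleaving n left right ≤ L * n ^ (length left + length right)) ×
  (2 ≤ L → L * n ^ (length left + length right) ≤ 1029 * sumInterleaving n left right)
sumInterleaving-Θ n left right L C<n eL eR m³≤Cn = upper , lower
  where
  o = countOp qry left + countOp upd right
  I = sumInterleaving₀ n L L
  marginal≡ : sumInterleaving n left right ≡ n ^ o * I
  marginal≡ = trans (sumInterleaving-marginal n left right) (cong₂ (λ p q → n ^ o * sumInterleaving₀ n p q) eL eR)
  length≡ : length left + length right ≡ o + (L + L)
  length≡ = trans (cong₂ _+_ (trans (length≡countOp+countOp upd left) (cong (countOp qry left +_) eL))
                             (trans (length≡countOp+countOp qry right) (cong (countOp upd right +_) eR)))
                  (+-interchange (countOp qry left) L (countOp upd right) L)
  n^m≡ : n ^ (length left + length right) ≡ n ^ o * n ^ (L + L)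
  n^m≡ = trans (cong (n ^_) length≡) (^-distribˡ-+-* n o (L + L))
  upper : sumInterleaving n left right ≤ L * n ^ (length left + length right)
  upper = begin
    sumInterleaving n left right  ≡⟨ marginal≡ ⟩
    n ^ o * I                     ≤⟨ *-monoʳ-≤ (n ^ o) (sumInterleaving₀-upper n L L) ⟩
    n ^ o * (L * n ^ (L + L))     ≡⟨ *-left-swap (n ^ o) L _ ⟩
    L * (n ^ o * n ^ (L + L))     ≡⟨ cong (L *_) n^m≡ ⟨
    L * n ^ (length left + length right)  ∎
    where open ≤-Reasoning
  lower : 2 ≤ L → L * n ^ (length left + length right) ≤ 1029 * sumInterleaving n left right
  lower 2≤L = begin
    L * n ^ (length left + length right)  ≡⟨ cong (L *_) n^m≡ ⟩
    L * (n ^ o * n ^ (L + L))     ≡⟨ *-left-swap L (n ^ o) _ ⟩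
    n ^ o * (L * n ^ (L + L))     ≤⟨ *-monoʳ-≤ (n ^ o) (sumInterleaving₀-lower n L 2≤L 2L≤n) ⟩
    n ^ o * (1029 * I)            ≡⟨ *-left-swap (n ^ o) 1029 I ⟩
    1029 * (n ^ o * I)            ≡⟨ cong (1029 *_) marginal≡ ⟨
    1029 * sumInterleaving n left right  ∎
    where
    open ≤-Reasoning
    2L≤n = ≤-trans (≤-reflexive (cong₂ _+_ (sym eL) (sym eR)))
                   (≤-trans (+-mono-≤ (countOp≤length upd left) (countOp≤length qry right)) (m³≤Cn⇒m≤n C<n m³≤Cn))

collisionCount-small : ∀ {C e} n left right → suc (e * e * e * (C * C)) ≤ n →
  (length left + length right) ^ 3 ≤ C * n → e * collisionCount n left right ≤ n ^ (length left + length right)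
collisionCount-small {C} {e} n left right K<n m³≤Cn = *-cancelˡ-≤ n {{>-nonZero (≤-trans (s≤s z≤n) K<n)}} (begin
  n * (e * collisionCount n left right)  ≡⟨ cong (λ c → n * (e * c)) (collisionCount≡dupCount n left right) ⟩
  n * (e * dupCount n m)                 ≡⟨ *-left-swap n e _ ⟩
  e * (n * dupCount n m)                 ≤⟨ *-monoʳ-≤ e (dupCount-bound n m) ⟩
  e * (m * m * n ^ m)                    ≡⟨ *-assoc e (m * m) _ ⟨
  e * (m * m) * n ^ m                    ≤⟨ *-monoˡ-≤ (n ^ m) (m³≤Cn⇒e*m²≤n {C} {e} {n} {m} K<n m³≤Cn) ⟩
  n * n ^ m                              ∎)
  where
  open ≤-Reasoning
  m = length left + length right

lemma5p2 : (C : ℕ) →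
    -- E[l] = Θ(L): constant k ≥ 1 with L/k ≤ E[l] ≤ L (for L ≥ 2)
    Σ ℕ (λ k → Σ ℕ (λ N → 1 ≤ k ×
      ((n : ℕ) (left right : List Op) (L : ℕ) → N ≤ n →
        countOp upd left ≡ L → countOp qry right ≡ L →
        (length left + length right) ^ 3 ≤ C * n →
        (sumInterleaving n left right ≤ L * n ^ (length left + length right))
        × (2 ≤ L → L * n ^ (length left + length right) ≤ k * sumInterleaving n left right)))) ×
    -- P(some index touched twice) = o(1): for every ε = 1/e
    ((e : ℕ) → 1 ≤ e → Σ ℕ (λ N →
      (n : ℕ) (left right : List Op) → N ≤ n →
        (length left + length right) ^ 3 ≤ C * n →
        e * collisionCount n left right ≤ n ^ (length left + length right)))
lemma5p2 C = (1029 , suc C , s≤s z≤n , sumInterleaving-Θ {C})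
           , λ e _ → suc (e * e * e * (C * C)) , collisionCount-small {C} {e}
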